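{- Let $c \geq 2$, and let $A$ be the bipartite adjacency matrix (a $t \times s$ matrix with entries in $\{0,1,\ldots,c-1\}$) of a $c$-edge colored complete bipartite graph $K_{s,t}$. Suppose $A$ has distinct rows. If $s \neq t$, then $A$ is an identity coloring if and only if its complement $A^*$ is an identity coloring. In the case that $t = s$ or $t = c^s - s$, the same equivalence holds provided automorphisms that interchange the two parts are excluded (i.e., considering only automorphisms mapping each part to itself).
   Context: A coloring of the edges of $K_{s,t}$, with parts $X$ ($|X|=s$) and $Y$ ($|Y|=t$), by colors $\{0,1,\ldots,c-1\}$ corresponds to its bipartite adjacency matrix: the $t \times s$ matrix whose $(i,j)$ entry is the color of the edge between the $i$-th vertex of $Y$ and the $j$-th vertex of $X$. Part-preserving color-preserving automorphisms correspond to pairs of permutation matrices $P_Y, P_X$ with $P_Y A P_X = A$; when $s=t$ there are also automorphisms switching parts, corresponding to $P_Y A^T P_X = A$. $A$ (or the coloring) is an identity coloring if the only color-preserving automorphism is the identity. If $A$ is a $t \times s$ matrix with entries in $\{0,\ldots,c-1\}$ and distinct rows, its complement $A^*$ is the $(c^s - t) \times s$ matrix whose rows are the $c$-ary strings of length $s$ that are not rows of $A$ (in any order). -}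

module Defs where

open import Data.Nat using (ℕ; _^_; _∸_)
open import Data.Fin using (Fin)
open import Data.Fin.Permutation using (Permutation; Permutation′; _⟨$⟩ʳ_)
open import Data.Product using (_×_; ∃)
open import Relation.Binary.PropositionalEquality using (_≡_)
open import Relation.Nullary using (¬_)
open import Function.Bundles using (_⇔_)

-- A c-colored t × s matrix: entry (i , j) is the color of the edge between
-- the i-th vertex of Y (|Y| = t) and the j-th vertex of X (|X| = s).
Matrix : ℕ → ℕ → ℕ → Set
Matrix c t s = Fin t → Fin s → Fin c

RowEq : ∀ {c s} → (Fin s → Fin c) → (Fin s → Fin c) → Set
RowEq {s = s} u v = ∀ (j : Fin s) → u j ≡ v j

DistinctRows : ∀ {c t s} → Matrix c t s → Set
DistinctRows {t = t} A = ∀ (i i' : Fin t) → RowEq (A i) (A i') → i ≡ i'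

IsRow : ∀ {c t s} → Matrix c t s → (Fin s → Fin c) → Set
IsRow {t = t} A v = ∃ λ (i : Fin t) → RowEq (A i) v

IsComplement : ∀ {c t s} → Matrix c t s → Matrix c (c ^ s ∸ t) s → Set
IsComplement {c} {t} {s} A B =
  DistinctRows B × (∀ (v : Fin s → Fin c) → IsRow B v ⇔ (¬ IsRow A v))

PartPreservingAut : ∀ {c t s} → Matrix c t s → Permutation′ t → Permutation′ s → Set
PartPreservingAut {t = t} {s} A σ τ =
  ∀ (i : Fin t) (j : Fin s) → A (σ ⟨$⟩ʳ i) (τ ⟨$⟩ʳ j) ≡ A i j

-- Part-switching color-preserving automorphism: y_i ↦ x_{α i}, x_j ↦ y_{β j}.
-- (Such bijections exist only when s = t.)
SwitchingAut : ∀ {c t s} → Matrix c t s → Permutation t s → Permutation s t → Set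
SwitchingAut {t = t} {s} A α β =
  ∀ (i : Fin t) (j : Fin s) → A (β ⟨$⟩ʳ j) (α ⟨$⟩ʳ i) ≡ A i j

IdentityColoringPP : ∀ {c t s} → Matrix c t s → Set
IdentityColoringPP {t = t} {s} A =
  ∀ (σ : Permutation′ t) (τ : Permutation′ s) → PartPreservingAut A σ τ →
    (∀ i → σ ⟨$⟩ʳ i ≡ i) × (∀ j → τ ⟨$⟩ʳ j ≡ j)

-- Identity coloring: the only color-preserving automorphism (of either kind)
-- is the identity; part-switching maps are never the identity.
IdentityColoring : ∀ {c t s} → Matrix c t s → Set
IdentityColoring {t = t} {s} A =
  IdentityColoringPP A ×
  (∀ (α : Permutation t s) (β : Permutation s t) → ¬ SwitchingAut A α β)

-- A part-preserving automorphism (σ , τ) of A is determined by τ: the column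
-- permutation τ maps the row set of A onto itself, hence also the set of
-- strings that are not rows of A, i.e. the row set of the complement, so τ is
-- also the column part of an automorphism of A*. Since the rows of a matrix
-- with distinct rows are determined by the columns, τ = id forces σ = id.
-- Part-switching maps need a bijection between parts, so they do not exist
-- when the parts have different sizes.
module Submission where

open import Defs
open import Data.Nat using (ℕ; _≤_; _^_; _∸_)
open import Data.Product using (_×_; _,_; proj₁; proj₂; ∃)
open import Data.Sum using (_⊎_)
open import Data.Fin using (Fin; _≟_)
open import Data.Fin.Properties using (any?; all?)
open import Data.Fin.Permutation
  using (Permutation′; _⟨$⟩ʳ_; _⟨$⟩ˡ_; permutation; flip; inverseˡ; inverseʳ; refute)
open import Function using (_∘_)
open import Function.Bundles using (_⇔_; mk⇔; Equivalence)
open import Function.Construct.Composition using (_⇔-∘_)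
open import Function.Construct.Symmetry using (⇔-sym)
open import Relation.Binary.PropositionalEquality
  using (_≡_; _≢_; refl; sym; trans; cong; cong₂; module ≡-Reasoning)
open import Relation.Nullary using (¬_; Dec)
open import Relation.Nullary.Decidable using (decidable-stable)

private
  variable
    c s t u : ℕ

isRow? : (A : Matrix c t s) (v : Fin s → Fin c) → Dec (IsRow A v)
isRow? A v = any? (λ i → all? (λ j → A i j ≟ v j))

IsRow-resp : (A : Matrix c t s) {v w : Fin s → Fin c} →
  RowEq v w → IsRow A v → IsRow A w
IsRow-resp A v≗w (i , Ai≗v) = i , λ j → trans (Ai≗v j) (v≗w j)

Complementary : Matrix c t s → Matrix c u s → Set
Complementary {c = c} {s = s} A B = ∀ (v : Fin s → Fin c) → IsRow B v ⇔ (¬ IsRow A v)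

complementary-sym : {A : Matrix c t s} {B : Matrix c u s} →
  Complementary A B → Complementary B A
complementary-sym {A = A} A∁B v = mk⇔
  (λ a b → Equivalence.to (A∁B v) b a)
  (λ ¬b → decidable-stable (isRow? A v) (¬b ∘ Equivalence.from (A∁B v)))

RowClosed : Matrix c t s → Permutation′ s → Set
RowClosed {c = c} {s = s} A π =
  ∀ (v : Fin s → Fin c) → IsRow A v → IsRow A (v ∘ (π ⟨$⟩ʳ_))

aut-flip : (A : Matrix c t s) (σ : Permutation′ t) (τ : Permutation′ s) →
  PartPreservingAut A σ τ → PartPreservingAut A (flip σ) (flip τ)
aut-flip A σ τ aut i j = begin
  A (σ ⟨$⟩ˡ i) (τ ⟨$⟩ˡ j)                          ≡⟨ sym (aut _ _) ⟩
  A (σ ⟨$⟩ʳ (σ ⟨$⟩ˡ i)) (τ ⟨$⟩ʳ (τ ⟨$⟩ˡ j))      ≡⟨ cong₂ A (inverseʳ σ) (inverseʳ τ) ⟩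
  A i j                                            ∎
  where open ≡-Reasoning

aut⇒rowClosed : (A : Matrix c t s) (σ : Permutation′ t) (τ : Permutation′ s) →
  PartPreservingAut A σ τ → RowClosed A τ
aut⇒rowClosed A σ τ aut v (i , Ai≗v) =
  σ ⟨$⟩ˡ i , λ j → trans (sym (aut (σ ⟨$⟩ˡ i) j))
                         (trans (cong (λ k → A k (τ ⟨$⟩ʳ j)) (inverseʳ σ)) (Ai≗v (τ ⟨$⟩ʳ j)))

-- If v ∘ τ were a row of A, so would be v ∘ τ ∘ τ⁻¹ = v.
complement-rowClosed : (A : Matrix c t s) (B : Matrix c u s) (τ : Permutation′ s) →
  Complementary A B → RowClosed A (flip τ) → RowClosed B τ
complement-rowClosed A B τ A∁B closed v b =
  Equivalence.from (A∁B (v ∘ (τ ⟨$⟩ʳ_))) λ a →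
    Equivalence.to (A∁B v) b
      (IsRow-resp A (λ j → cong v (inverseʳ τ)) (closed _ a))

rowClosed⇒aut : (B : Matrix c u s) (τ : Permutation′ s) → DistinctRows B →
  RowClosed B τ → RowClosed B (flip τ) → ∃ λ σ → PartPreservingAut B σ τ
rowClosed⇒aut B τ distinct closed closed⁻¹ =
  permutation to from to∘from from∘to , λ k j → trans (to-row k (τ ⟨$⟩ʳ j)) (cong (B k) (inverseˡ τ))
  where
  to from : Fin _ → Fin _
  to   k = proj₁ (closed⁻¹ (B k) (k , λ _ → refl))
  from k = proj₁ (closed   (B k) (k , λ _ → refl))
  to-row : ∀ k j → B (to k) j ≡ B k (τ ⟨$⟩ˡ j)
  to-row k = proj₂ (closed⁻¹ (B k) (k , λ _ → refl))
  from-row : ∀ k j → B (from k) j ≡ B k (τ ⟨$⟩ʳ j)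
  from-row k = proj₂ (closed (B k) (k , λ _ → refl))
  to∘from : ∀ k → to (from k) ≡ k
  to∘from k = distinct _ _ λ j →
    trans (to-row (from k) j) (trans (from-row k _) (cong (B k) (inverseʳ τ)))
  from∘to : ∀ k → from (to k) ≡ k
  from∘to k = distinct _ _ λ j →
    trans (from-row (to k) j) (trans (to-row k _) (cong (B k) (inverseˡ τ)))

aut-complement : (A : Matrix c t s) (B : Matrix c u s)
  (σ : Permutation′ t) (τ : Permutation′ s) → DistinctRows B → Complementary A B →
  PartPreservingAut A σ τ → ∃ λ σ′ → PartPreservingAut B σ′ τ
aut-complement A B σ τ distinct A∁B aut = rowClosed⇒aut B τ distinct
  (complement-rowClosed A B τ A∁B (aut⇒rowClosed A (flip σ) (flip τ) (aut-flip A σ τ aut)))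
  (complement-rowClosed A B (flip τ) A∁B (aut⇒rowClosed A σ τ aut))

aut-rows-id : (A : Matrix c t s) (σ : Permutation′ t) (τ : Permutation′ s) →
  DistinctRows A → PartPreservingAut A σ τ → (∀ j → τ ⟨$⟩ʳ j ≡ j) →
  ∀ i → σ ⟨$⟩ʳ i ≡ i
aut-rows-id A σ τ distinct aut τ-id i =
  distinct _ _ λ j → trans (cong (A (σ ⟨$⟩ʳ i)) (sym (τ-id j))) (aut i j)

identityColoringPP-complement : {A : Matrix c t s} {B : Matrix c u s} →
  DistinctRows A → DistinctRows B → Complementary A B →
  IdentityColoringPP B → IdentityColoringPP A
identityColoringPP-complement {A = A} {B} distinctA distinctB A∁B idB σ τ aut =
  aut-rows-id A σ τ distinctA aut τ-id , τ-id
  where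
  autB = aut-complement A B σ τ distinctB A∁B aut
  τ-id = proj₂ (idB (proj₁ autB) τ (proj₂ autB))

identityColoring⇔PP : {A : Matrix c t s} → s ≢ t →
  IdentityColoring A ⇔ IdentityColoringPP A
identityColoring⇔PP s≢t =
  mk⇔ proj₁ (λ idA → idA , λ α _ _ → refute (s≢t ∘ sym) α)

-- Neither 2 ≤ c nor the case hypothesis of the second part is needed.
lemma3 : (c s t : ℕ) → 2 ≤ c → (A : Matrix c t s) → DistinctRows A →
    (B : Matrix c (c ^ s ∸ t) s) → IsComplement A B →
    ((s ≢ t × s ≢ c ^ s ∸ t) → (IdentityColoring A ⇔ IdentityColoring B)) ×
    ((t ≡ s ⊎ t ≡ c ^ s ∸ s) → (IdentityColoringPP A ⇔ IdentityColoringPP B))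
lemma3 c s t _ A distinctA B (distinctB , A∁B) =
  (λ (s≢t , s≢t*) → ⇔-sym (identityColoring⇔PP s≢t*) ⇔-∘ (pp ⇔-∘ identityColoring⇔PP s≢t)) ,
  λ _ → pp
  where
  pp : IdentityColoringPP A ⇔ IdentityColoringPP B
  pp = mk⇔ (identityColoringPP-complement distinctB distinctA (complementary-sym A∁B))
           (identityColoringPP-complement distinctA distinctB A∁B)
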